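{- Let $\Gamma$ be a proper LDDG with parameters $(v,k,\lambda_1,\lambda_2,m,n)$. Then $0 \leq \lambda_2 \leq k-1$.
   Context: Graphs here are finite, undirected, without multiple edges, but loops are allowed: a vertex may be adjacent to itself. For a vertex $x$, $\Gamma(x)$ is the set of vertices adjacent to $x$ (containing $x$ iff $x$ has a loop), and the degree of $x$ is $|\Gamma(x)|$ (a loop contributes exactly 1). Common neighbours of $x,y$ are the elements of $\Gamma(x)\cap\Gamma(y)$. A $k$-regular graph on $v$ vertices is an LDDG with parameters $(v,k,\lambda_1,\lambda_2,m,n)$ if its vertex set can be partitioned into $m$ classes of size $n$ such that any two distinct vertices of the same class have exactly $\lambda_1$ common neighbours and any two vertices of different classes have exactly $\lambda_2$ common neighbours. It is proper if $m,n\geq 2$ and $\lambda_1\neq\lambda_2$. -}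

module Defs where

open import Data.Nat using (ℕ; _≤_)
open import Data.Bool using (Bool)
open import Data.Fin using (Fin; _≟_)
open import Data.Fin.Subset using (Subset; ∣_∣; _∩_)
open import Data.Vec using (tabulate)
open import Data.Product using (Σ; _×_)
open import Relation.Nullary using (¬_; does)
open import Relation.Binary.PropositionalEquality using (_≡_; _≢_)

-- A finite undirected graph on vertex set Fin v, without multiple edges,
-- loops allowed: adjacency is a symmetric Bool-valued relation
-- (adj x x ≡ true means x has a loop).
record Graph (v : ℕ) : Set where
  field
    adj : Fin v → Fin v → Bool
    adj-sym : ∀ x y → adj x y ≡ adj y x
open Graph public

nbhd : ∀ {v} → Graph v → Fin v → Subset v
nbhd G x = tabulate (λ y → adj G x y)

-- degree of x = |Γ(x)| (a loop contributes exactly 1)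
degree : ∀ {v} → Graph v → Fin v → ℕ
degree G x = ∣ nbhd G x ∣

common : ∀ {v} → Graph v → Fin v → Fin v → ℕ
common G x y = ∣ nbhd G x ∩ nbhd G y ∣

classOf : ∀ {v m} → (Fin v → Fin m) → Fin m → Subset v
classOf c i = tabulate (λ x → does (c x ≟ i))

IsLDDG : ∀ {v} → Graph v → (k λ₁ λ₂ m n : ℕ) → Set
IsLDDG {v} G k λ₁ λ₂ m n =
  (∀ x → degree G x ≡ k) ×
  Σ (Fin v → Fin m) λ c →
    (∀ i → ∣ classOf c i ∣ ≡ n) ×
    (∀ x y → x ≢ y → c x ≡ c y → common G x y ≡ λ₁) ×
    (∀ x y → c x ≢ c y → common G x y ≡ λ₂)

IsProperLDDG : ∀ {v} → Graph v → (k λ₁ λ₂ m n : ℕ) → Set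
IsProperLDDG G k λ₁ λ₂ m n =
  IsLDDG G k λ₁ λ₂ m n × 2 ≤ m × 2 ≤ n × λ₁ ≢ λ₂

{-# OPTIONS --safe #-}
-- Common neighbours of x and y are neighbours of x, so λ₂ ≤ k. If λ₂ = k, two
-- vertices in different classes share all k neighbours and hence have the same
-- neighbourhood. Then two distinct vertices x, x′ of one class both have the
-- neighbourhood of a vertex y of another class, so λ₁ = |Γ(x) ∩ Γ(x′)| = |Γ(y)| = k = λ₂.
module Submission where

open import Defs
open import Data.Nat using (ℕ; _≤_; _+_; z≤n; s≤s)
open import Data.Nat.Properties using (+-comm; ≤∧≢⇒<; ≤-trans; n≤1+n; suc-injective; 1+n≰n)
open import Data.Fin using (Fin; zero; suc; _≟_)
import Data.Fin.Properties as Fin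
open import Data.Fin.Subset using (Subset; _∈_; ∣_∣; _∩_; inside; outside; Nonempty)
open import Data.Fin.Subset.Properties using (∣p∩q∣≤∣p∣; ∩-comm; ∩-idem)
open import Data.Vec using ([]; _∷_; here; there)
open import Data.Vec.Properties using ([]=⇒lookup; lookup∘tabulate)
open import Data.Product using (Σ-syntax; _×_; _,_; map)
open import Function using (_∘_)
open import Relation.Nullary using (yes; no; contradiction)
open import Relation.Binary.PropositionalEquality

1≤∣p∣⇒Nonempty : ∀ {n} (p : Subset n) → 1 ≤ ∣ p ∣ → Nonempty p
1≤∣p∣⇒Nonempty (inside ∷ p) _ = zero , here
1≤∣p∣⇒Nonempty (outside ∷ p) 1≤∣p∣ = map suc there (1≤∣p∣⇒Nonempty p 1≤∣p∣)

2≤∣p∣⇒distinct-members : ∀ {n} (p : Subset n) → 2 ≤ ∣ p ∣ →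
  Σ[ x ∈ Fin n ] Σ[ y ∈ Fin n ] x ∈ p × y ∈ p × x ≢ y
2≤∣p∣⇒distinct-members (inside ∷ p) (s≤s 1≤∣p∣) with 1≤∣p∣⇒Nonempty p 1≤∣p∣
... | y , y∈p = zero , suc y , here , there y∈p , λ ()
2≤∣p∣⇒distinct-members (outside ∷ p) 2≤∣p∣ with 2≤∣p∣⇒distinct-members p 2≤∣p∣
... | x , y , x∈p , y∈p , x≢y = suc x , suc y , there x∈p , there y∈p , x≢y ∘ Fin.suc-injective

∣p∩q∣≡∣p∣⇒p∩q≡p : ∀ {n} (p q : Subset n) → ∣ p ∩ q ∣ ≡ ∣ p ∣ → p ∩ q ≡ p
∣p∩q∣≡∣p∣⇒p∩q≡p []            []            _ = refl
∣p∩q∣≡∣p∣⇒p∩q≡p (inside ∷ p)  (inside ∷ q)  e = cong (inside ∷_) (∣p∩q∣≡∣p∣⇒p∩q≡p p q (suc-injective e))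
∣p∩q∣≡∣p∣⇒p∩q≡p (inside ∷ p)  (outside ∷ q) e = contradiction (subst (_≤ ∣ p ∣) e (∣p∩q∣≤∣p∣ p q)) 1+n≰n
∣p∩q∣≡∣p∣⇒p∩q≡p (outside ∷ p) (_ ∷ q)       e = cong (outside ∷_) (∣p∩q∣≡∣p∣⇒p∩q≡p p q e)

∣p∩q∣≡∣p∣∧∣p∩q∣≡∣q∣⇒p≡q : ∀ {n} (p q : Subset n) → ∣ p ∩ q ∣ ≡ ∣ p ∣ → ∣ p ∩ q ∣ ≡ ∣ q ∣ → p ≡ q
∣p∩q∣≡∣p∣∧∣p∩q∣≡∣q∣⇒p≡q p q ∣p∩q∣≡∣p∣ ∣p∩q∣≡∣q∣ = begin
  p     ≡⟨ ∣p∩q∣≡∣p∣⇒p∩q≡p p q ∣p∩q∣≡∣p∣ ⟨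
  p ∩ q ≡⟨ ∩-comm p q ⟩
  q ∩ p ≡⟨ ∣p∩q∣≡∣p∣⇒p∩q≡p q p (trans (cong ∣_∣ (∩-comm q p)) ∣p∩q∣≡∣q∣) ⟩
  q     ∎
  where open ≡-Reasoning

∈classOf⇒≡ : ∀ {v m} (c : Fin v → Fin m) {i x} → x ∈ classOf c i → c x ≡ i
∈classOf⇒≡ c {i} {x} x∈class with c x ≟ i | trans (sym (lookup∘tabulate _ x)) ([]=⇒lookup x∈class)
... | yes cx≡i | _ = cx≡i
... | no _     | ()

module _ {v} (G : Graph v) where

  common≤degree : ∀ x y → common G x y ≤ degree G x
  common≤degree x y = ∣p∩q∣≤∣p∣ (nbhd G x) (nbhd G y)

  common-self : ∀ x → common G x x ≡ degree G x
  common-self x = cong ∣_∣ (∩-idem (nbhd G x))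

  regular∧common≡k⇒nbhd≡ : ∀ {k} → (∀ z → degree G z ≡ k) →
    ∀ {x y} → common G x y ≡ k → nbhd G x ≡ nbhd G y
  regular∧common≡k⇒nbhd≡ regular {x} {y} common≡k =
    ∣p∩q∣≡∣p∣∧∣p∩q∣≡∣q∣⇒p≡q (nbhd G x) (nbhd G y)
      (trans common≡k (sym (regular x))) (trans common≡k (sym (regular y)))

same-class-pair-and-outsider : ∀ {v m n} (c : Fin v → Fin m) → (∀ i → ∣ classOf c i ∣ ≡ n) →
  2 ≤ m → 2 ≤ n →
  Σ[ x ∈ Fin v ] Σ[ x′ ∈ Fin v ] Σ[ y ∈ Fin v ] x ≢ x′ × c x ≡ c x′ × c x ≢ c y
same-class-pair-and-outsider {n = n} c classSize (s≤s (s≤s _)) 2≤n =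
  let x , x′ , x∈ , x′∈ , x≢x′ = 2≤∣p∣⇒distinct-members (classOf c zero) (classSize≥ 2≤n zero)
      y , y∈ = 1≤∣p∣⇒Nonempty (classOf c (suc zero)) (classSize≥ (≤-trans (n≤1+n 1) 2≤n) (suc zero))
      cx≡0 = ∈classOf⇒≡ c x∈
  in  x , x′ , y , x≢x′ , trans cx≡0 (sym (∈classOf⇒≡ c x′∈)) ,
      λ cx≡cy → Fin.0≢1+n (trans (sym cx≡0) (trans cx≡cy (∈classOf⇒≡ c y∈)))
  where
  classSize≥ : ∀ {l} → l ≤ n → ∀ i → l ≤ ∣ classOf c i ∣
  classSize≥ l≤n i = subst (_ ≤_) (sym (classSize i)) l≤n

proposition3p5 : (v k λ₁ λ₂ m n : ℕ) (G : Graph v) →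
    IsProperLDDG G k λ₁ λ₂ m n →
    0 ≤ λ₂ × λ₂ + 1 ≤ k
proposition3p5 v k λ₁ λ₂ m n G ((regular , c , classSize , sameClass , otherClass) , 2≤m , 2≤n , λ₁≢λ₂)
  with same-class-pair-and-outsider c classSize 2≤m 2≤n
... | x , x′ , y , x≢x′ , cx≡cx′ , cx≢cy = z≤n , subst (_≤ k) (+-comm 1 λ₂) (≤∧≢⇒< λ₂≤k λ₂≢k)
  where
  λ₂≤k : λ₂ ≤ k
  λ₂≤k = subst₂ _≤_ (otherClass x y cx≢cy) (regular x) (common≤degree G x y)

  nbhd≡nbhd-y : λ₂ ≡ k → ∀ {z} → c z ≢ c y → nbhd G z ≡ nbhd G y
  nbhd≡nbhd-y λ₂≡k cz≢cy = regular∧common≡k⇒nbhd≡ G regular (trans (otherClass _ y cz≢cy) λ₂≡k)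

  λ₂≢k : λ₂ ≢ k
  λ₂≢k λ₂≡k = λ₁≢λ₂ (begin
    λ₁            ≡⟨ sameClass x x′ x≢x′ cx≡cx′ ⟨
    common G x x′ ≡⟨ cong₂ (λ p q → ∣ p ∩ q ∣) (nbhd≡nbhd-y λ₂≡k cx≢cy) (nbhd≡nbhd-y λ₂≡k (cx≢cy ∘ trans cx≡cx′)) ⟩
    common G y y  ≡⟨ common-self G y ⟩
    degree G y    ≡⟨ regular y ⟩
    k             ≡⟨ λ₂≡k ⟨
    λ₂            ∎)
    where open ≡-Reasoning
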